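{- Let $n,r \in \mathbb{N}$, $\varepsilon > 0$, and let $\chi$ be an $r$-colouring of $E(K_n)$. There exist pairwise disjoint sets of vertices $S_1,\dots,S_r$ and $W$ such that $$|W| \ge \bigg( \frac{1+\varepsilon}{r} \bigg)^{\sum_{j = 1}^r |S_j|} n,$$ and, for every $i \in [r]$, we have $|N_i(w) \cap W| \ge ( \frac{1}{r} - \varepsilon ) |W| - 1$ for every $w \in W$, and $(S_i,W)$ is a monochromatic book in colour $i$.
   Context: An $r$-colouring of $E(K_n)$ is a map $\chi\colon E(K_n)\to[r]$; $N_i(u)$ is the set of vertices $v\ne u$ with $\chi(uv)=i$. For disjoint vertex sets $A,B$, the pair $(A,B)$ is a monochromatic book in colour $i$ if every pair $uv$ of distinct vertices of $A\cup B$ with $\{u,v\}\not\subset B$ satisfies $\chi(uv)=i$.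
   Formalization: The parameter ε ranges over the positive rationals. -}

module Defs where

open import Data.Nat using (ℕ; zero; suc; NonZero)
open import Data.Fin using (Fin; _≟_)
open import Data.Fin.Subset using (Subset; _∈_; _∩_; ∣_∣)
open import Data.Bool using (Bool; _∧_; not)
open import Data.Vec using (tabulate; sum)
open import Data.Rational using (ℚ; 1ℚ; _*_; _+_; _-_; _/_; _≤_)
open import Data.Integer using (+_)
open import Data.Product using (_×_)
open import Data.Empty using (⊥)
open import Relation.Nullary using (¬_)
open import Relation.Nullary.Decidable using (⌊_⌋)
open import Relation.Binary.PropositionalEquality using (_≡_; _≢_)

-- An r-colouring of E(K_n): vertices are Fin n, colours are Fin r (colour i ∈ [r]
-- is represented by Fin r). χ u v is the colour of edge uv for u ≢ v; values on
-- the diagonal (u = v) are irrelevant and never used.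
record Colouring (n r : ℕ) : Set where
  field
    col  : Fin n → Fin n → Fin r
    symm : ∀ u v → col u v ≡ col v u
open Colouring public

N : ∀ {n r} → Colouring n r → Fin r → Fin n → Subset n
N χ i u = tabulate (λ v → not ⌊ v ≟ u ⌋ ∧ ⌊ col χ u v ≟ i ⌋)

Disjoint : ∀ {n} → Subset n → Subset n → Set
Disjoint A B = ∀ v → v ∈ A → v ∈ B → ⊥

-- (A , B) is a monochromatic book in colour i: every pair uv of distinct
-- vertices of A ∪ B, not both in B, has colour i.
MonoBook : ∀ {n r} → Colouring n r → Fin r → Subset n → Subset n → Set
MonoBook χ i A B =
  ∀ u v → u ≢ v → (u ∈ A × (v ∈ A ⊎' v ∈ B) ⊎' u ∈ B × v ∈ A) → col χ u v ≡ i
  where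
    open import Data.Sum using () renaming (_⊎_ to _⊎'_)

ℕ→ℚ : ℕ → ℚ
ℕ→ℚ k = (+ k) / 1

_^ℚ_ : ℚ → ℕ → ℚ
q ^ℚ zero = 1ℚ
q ^ℚ suc k = q * (q ^ℚ k)

totalSize : ∀ {n r} → (Fin r → Subset n) → ℕ
totalSize S = sum (tabulate (λ j → ∣ S j ∣))

-- Start from S_i = ∅ and W = V(K_n). While some w ∈ W has fewer than
-- (1/r - ε)|W| - 1 neighbours in W in some colour, its |W| - 1 neighbours in W cannot all lie
-- in colour classes smaller than (1 + ε)|W|/r, so some colour j has at least that many; move w
-- into S_j and replace W by N_j(w) ∩ W. Every (S_i, W) stays a monochromatic book in colour i,
-- each vertex added to the S_j keeps at least a (1 + ε)/r fraction of W, and since |W| strictly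
-- decreases the process stops, at a W in which every vertex has the required degrees.
module Submission where

open import Defs
open import Algebra.Bundles using (CommutativeMonoid)
import Algebra.Properties.CommutativeSemigroup as CommutativeSemigroupProperties
open import Data.Bool using (Bool; true; false; _∧_; not)
open import Data.Bool.Properties using (∧-commutativeMonoid)
open import Data.Empty using (⊥-elim)
open import Data.Fin using (Fin; zero; suc; _≟_; punchIn)
open import Data.Fin.Properties using (any?; punchInᵢ≢i; suc-injective)
open import Data.Fin.Subset using (Subset; _∈_; _∉_; _∩_; _∪_; ⁅_⁆; ∣_∣; ⊥; ⊤)
open import Data.Fin.Subset.Properties
  using (_∈?_; ∪-identityʳ; x∈p∪q⁻; x∈p∩q⁻; x∈⁅y⁆⇒x≡y; p∩q⊆q; p⊂q⇒∣p∣<∣q∣; ∉⊥; ∣⊥∣≡0; ∣⊤∣≡n)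
open import Data.Integer as ℤ using (+_)
import Data.Integer.Properties as ℤ
open import Data.Integer.Solver renaming (module +-*-Solver to ℤ-Solver)
open import Data.Nat as ℕ using (ℕ; zero; suc; NonZero)
import Data.Nat.Properties as ℕ
open import Data.Product using (Σ-syntax; ∃-syntax; _×_; _,_; proj₁; proj₂; map₂)
open import Data.Rational
  using (ℚ; 0ℚ; 1ℚ; _+_; _*_; _-_; _/_; _≤_; _<_; toℚᵘ; NonNegative; positive)

open import Data.Rational.Properties
  using ( module ≤-Reasoning; toℚᵘ-fromℚᵘ; toℚᵘ-injective; toℚᵘ-homo-+; toℚᵘ-homo-*
        ; normalize-nonNeg; nonNegative⁻¹; nonNeg*nonNeg⇒nonNeg; ≤-reflexive; <⇒≤; ≰⇒>; <-irrefl
        ; ≮⇒≥; <-≤-trans; _≤?_; _<?_; *-zeroˡ; *-identityˡ; *-assoc; +-identityʳ; +-mono-≤; +-monoʳ-≤; +-monoˡ-<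
        ; *-monoˡ-≤-nonNeg; nonNeg+nonNeg⇒nonNeg; pos⇒nonNeg)
import Data.Rational.Unnormalised as ℚᵘ
import Data.Rational.Unnormalised.Properties as ℚᵘ
open import Data.Rational.Solver renaming (module +-*-Solver to ℚ-Solver)
open import Data.Sum using (_⊎_; inj₁; inj₂; [_,_]′)
open import Data.Vec as Vec using ([]; _∷_; lookup; tabulate; here; there)
open import Data.Vec.Properties using (lookup∘tabulate; lookup-zipWith; []=⇒lookup)
open import Data.Vec.Functional using (removeAt; updateAt)
open import Data.Vec.Functional.Properties using (updateAt-updates; updateAt-minimal)
open import Function using (_∘_)
open import Relation.Nullary using (¬_; yes; no)
open import Relation.Nullary.Decidable using (Dec; ⌊_⌋; ⌊⌋-map′; _×-dec_; toSum; decidable-stable)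
open import Relation.Binary.PropositionalEquality hiding ([_])

open import Algebra.Properties.CommutativeMonoid.Sum ℕ.+-0-commutativeMonoid
  using (sum; sum-syntax; sum-remove; sum-cong-≗; sum-replicate-zero; ∑-comm)
open CommutativeSemigroupProperties ℕ.+-commutativeSemigroup using (x∙yz≈y∙xz)
private
  module ∧ = CommutativeSemigroupProperties (CommutativeMonoid.commutativeSemigroup ∧-commutativeMonoid)

toℚᵘ-ℕ→ℚ : ∀ k → toℚᵘ (ℕ→ℚ k) ℚᵘ.≃ ℚᵘ.mkℚᵘ (+ k) 0
toℚᵘ-ℕ→ℚ k = toℚᵘ-fromℚᵘ (ℚᵘ.mkℚᵘ (+ k) 0)

ℕ→ℚ-+ : ∀ a b → ℕ→ℚ (a ℕ.+ b) ≡ ℕ→ℚ a + ℕ→ℚ b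
ℕ→ℚ-+ a b = toℚᵘ-injective (begin
  toℚᵘ (ℕ→ℚ (a ℕ.+ b))                      ≈⟨ toℚᵘ-ℕ→ℚ (a ℕ.+ b) ⟩
  ℚᵘ.mkℚᵘ (+ (a ℕ.+ b)) 0                   ≈⟨ ℚᵘ.*≡* cross ⟩
  ℚᵘ.mkℚᵘ (+ a) 0 ℚᵘ.+ ℚᵘ.mkℚᵘ (+ b) 0      ≈⟨ ℚᵘ.+-cong (toℚᵘ-ℕ→ℚ a) (toℚᵘ-ℕ→ℚ b) ⟨
  toℚᵘ (ℕ→ℚ a) ℚᵘ.+ toℚᵘ (ℕ→ℚ b)           ≈⟨ toℚᵘ-homo-+ (ℕ→ℚ a) (ℕ→ℚ b) ⟨
  toℚᵘ (ℕ→ℚ a + ℕ→ℚ b)                      ∎)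
  where
  open ℚᵘ.≃-Reasoning
  open ℤ-Solver
  cross : + (a ℕ.+ b) ℤ.* + 1 ≡ (+ a ℤ.* + 1 ℤ.+ + b ℤ.* + 1) ℤ.* + 1
  cross = trans (cong (ℤ._* + 1) (ℤ.pos-+ a b))
    (solve 2 (λ x y → (x :+ y) :* con (+ 1) := (x :* con (+ 1) :+ y :* con (+ 1)) :* con (+ 1)) refl (+ a) (+ b))

ℕ→ℚ-suc : ∀ k → ℕ→ℚ (suc k) ≡ 1ℚ + ℕ→ℚ k
ℕ→ℚ-suc = ℕ→ℚ-+ 1

ℕ→ℚ-nonNeg : ∀ k → NonNegative (ℕ→ℚ k)
ℕ→ℚ-nonNeg k = normalize-nonNeg k 1

ℕ→ℚ-*-inverseʳ : ∀ n .{{_ : ℕ.NonZero n}} → ℕ→ℚ n * (+ 1 / n) ≡ 1ℚ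
ℕ→ℚ-*-inverseʳ n@(suc _) = toℚᵘ-injective (begin
  toℚᵘ (ℕ→ℚ n * (+ 1 / n))
    ≈⟨ toℚᵘ-homo-* (ℕ→ℚ n) (+ 1 / n) ⟩
  toℚᵘ (ℕ→ℚ n) ℚᵘ.* toℚᵘ (+ 1 / n)
    ≈⟨ ℚᵘ.*-cong (toℚᵘ-ℕ→ℚ n) (toℚᵘ-fromℚᵘ (ℚᵘ.mkℚᵘ (+ 1) (ℕ.pred n))) ⟩
  ℚᵘ.mkℚᵘ (+ n) 0 ℚᵘ.* ℚᵘ.mkℚᵘ (+ 1) (ℕ.pred n)
    ≈⟨ ℚᵘ.*≡* cross ⟩
  toℚᵘ 1ℚ ∎)
  where
  open ℚᵘ.≃-Reasoning
  open ℤ-Solver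
  cross : (+ n ℤ.* + 1) ℤ.* + 1 ≡ + 1 ℤ.* (+ 1 ℤ.* + n)
  cross = solve 1 (λ x → (x :* con (+ 1)) :* con (+ 1) := con (+ 1) :* (con (+ 1) :* x)) refl (+ n)

ℕ→ℚ-sum-≤ : ∀ {m} (c : Fin m → ℕ) (B : ℚ) → (∀ j → ℕ→ℚ (c j) ≤ B) → ℕ→ℚ (sum c) ≤ ℕ→ℚ m * B
ℕ→ℚ-sum-≤ {zero}  c B c≤B = ≤-reflexive (sym (*-zeroˡ B))
ℕ→ℚ-sum-≤ {suc m} c B c≤B = begin
  ℕ→ℚ (c zero ℕ.+ sum (c ∘ suc))      ≡⟨ ℕ→ℚ-+ (c zero) _ ⟩
  ℕ→ℚ (c zero) + ℕ→ℚ (sum (c ∘ suc))  ≤⟨ +-mono-≤ (c≤B zero) (ℕ→ℚ-sum-≤ (c ∘ suc) B (c≤B ∘ suc)) ⟩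
  B + ℕ→ℚ m * B                       ≡⟨ solve 2 (λ B m → B :+ m :* B := (con 1ℚ :+ m) :* B) refl B (ℕ→ℚ m) ⟩
  (1ℚ + ℕ→ℚ m) * B                    ≡⟨ cong (_* B) (ℕ→ℚ-suc m) ⟨
  ℕ→ℚ (suc m) * B                     ∎
  where
  open ≤-Reasoning
  open ℚ-Solver

pigeonhole-identity : ∀ u ε x R → (1ℚ + R) * u ≡ 1ℚ →
  ((u - ε) * x - 1ℚ + R * ((1ℚ + ε) * u * x)) + ε * u * x ≡ x - 1ℚ
pigeonhole-identity u ε x R [1+R]u≡1 = begin
  ((u - ε) * x - 1ℚ + R * ((1ℚ + ε) * u * x)) + ε * u * x
    ≡⟨ solve 4 (λ u ε x R → ((u :- ε) :* x :- con 1ℚ :+ R :* ((con 1ℚ :+ ε) :* u :* x)) :+ ε :* u :* x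
                         := x :* (con 1ℚ :+ ε) :* ((con 1ℚ :+ R) :* u) :- x :* ε :- con 1ℚ) refl u ε x R ⟩
  x * (1ℚ + ε) * ((1ℚ + R) * u) - x * ε - 1ℚ
    ≡⟨ cong (λ t → x * (1ℚ + ε) * t - x * ε - 1ℚ) [1+R]u≡1 ⟩
  x * (1ℚ + ε) * 1ℚ - x * ε - 1ℚ
    ≡⟨ solve 2 (λ ε x → x :* (con 1ℚ :+ ε) :* con 1ℚ :- x :* ε :- con 1ℚ := x :- con 1ℚ) refl ε x ⟩
  x - 1ℚ ∎
  where
  open ≡-Reasoning
  open ℚ-Solver

-- Were c i below the bound, then d - 1 = Σ c ≤ c i + r (1 + ε) u d < d - 1 - ε u d.
upper-bounds⇒lower-bound : ∀ {r} (u ε : ℚ) .{{_ : NonNegative u}} .{{_ : NonNegative ε}} →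
  ℕ→ℚ (suc r) * u ≡ 1ℚ → (c : Fin (suc r) → ℕ) {d : ℕ} → suc (sum c) ≡ d →
  (∀ j → ℕ→ℚ (c j) ≤ (1ℚ + ε) * u * ℕ→ℚ d) → ∀ i → (u - ε) * ℕ→ℚ d - 1ℚ ≤ ℕ→ℚ (c i)
upper-bounds⇒lower-bound {r} u ε [1+r]u≡1 c refl c≤B i = ≮⇒≥ (λ light → <-irrefl refl (s<s light))
  where
  s = ℕ→ℚ (sum c)
  x = ℕ→ℚ (suc (sum c))
  B = (1ℚ + ε) * u * x
  T = (u - ε) * x - 1ℚ + ℕ→ℚ r * B
  εux≥0 : 0ℚ ≤ ε * u * x
  εux≥0 = nonNegative⁻¹ (ε * u * x)
    {{nonNeg*nonNeg⇒nonNeg (ε * u) {{nonNeg*nonNeg⇒nonNeg ε u}} x {{ℕ→ℚ-nonNeg (suc (sum c))}}}}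
  rest≤B : ∀ k → ℕ→ℚ (removeAt c i k) ≤ B
  rest≤B = c≤B ∘ punchIn i
  [1+r]u≡1′ : (1ℚ + ℕ→ℚ r) * u ≡ 1ℚ
  [1+r]u≡1′ = trans (cong (_* u) (sym (ℕ→ℚ-suc r))) [1+r]u≡1
  s<s : ℕ→ℚ (c i) < (u - ε) * x - 1ℚ → s < s
  s<s light = begin-strict
    ℕ→ℚ (sum c)                           ≡⟨ cong ℕ→ℚ (sum-remove c) ⟩
    ℕ→ℚ (c i ℕ.+ sum (removeAt c i))      ≡⟨ ℕ→ℚ-+ (c i) _ ⟩
    ℕ→ℚ (c i) + ℕ→ℚ (sum (removeAt c i))  ≤⟨ +-monoʳ-≤ (ℕ→ℚ (c i)) (ℕ→ℚ-sum-≤ (removeAt c i) B rest≤B) ⟩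
    ℕ→ℚ (c i) + ℕ→ℚ r * B                 <⟨ +-monoˡ-< (ℕ→ℚ r * B) light ⟩
    T                                     ≡⟨ +-identityʳ T ⟨
    T + 0ℚ                                ≤⟨ +-monoʳ-≤ T εux≥0 ⟩
    T + ε * u * x                         ≡⟨ pigeonhole-identity u ε x (ℕ→ℚ r) [1+r]u≡1′ ⟩
    x - 1ℚ                                ≡⟨ cong (_- 1ℚ) (ℕ→ℚ-suc (sum c)) ⟩
    1ℚ + s - 1ℚ                           ≡⟨ solve 1 (λ s → con 1ℚ :+ s :- con 1ℚ := s) refl s ⟩
    s                                     ∎
    where
    open ≤-Reasoning
    open ℚ-Solver

[_] : Bool → ℕ
[ true ]  = 1
[ false ] = 0

∣p∣≡∑[lookup] : ∀ {n} (p : Subset n) → ∣ p ∣ ≡ ∑[ v < n ] [ lookup p v ]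
∣p∣≡∑[lookup] []          = refl
∣p∣≡∑[lookup] (true ∷ p)  = cong suc (∣p∣≡∑[lookup] p)
∣p∣≡∑[lookup] (false ∷ p) = ∣p∣≡∑[lookup] p

-- `suc v ≟ suc w` is built with map′, so ⌊_⌋ of it does not reduce to ⌊ v ≟ w ⌋ by computation.
⌊suc≟suc⌋ : ∀ {m} (v w : Fin m) → ⌊ suc v ≟ suc w ⌋ ≡ ⌊ v ≟ w ⌋
⌊suc≟suc⌋ v w = ⌊⌋-map′ (cong suc) suc-injective (v ≟ w)

∑[≟]≡1 : ∀ {m} (c : Fin m) → ∑[ j < m ] [ ⌊ c ≟ j ⌋ ] ≡ 1
∑[≟]≡1 {suc m} zero    = cong suc (sum-replicate-zero m)
∑[≟]≡1 {suc m} (suc c) = trans (sum-cong-≗ (cong [_] ∘ ⌊suc≟suc⌋ c)) (∑[≟]≡1 c)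

∑-fibres : ∀ {n m} (b : Fin n → Bool) (f : Fin n → Fin m) →
           ∑[ j < m ] ∑[ v < n ] [ b v ∧ ⌊ f v ≟ j ⌋ ] ≡ ∑[ v < n ] [ b v ]
∑-fibres {m = m} b f = trans (∑-comm (λ j v → [ b v ∧ ⌊ f v ≟ j ⌋ ])) (sum-cong-≗ (λ v → fibre (b v) (f v)))
  where
  fibre : ∀ b c → ∑[ j < m ] [ b ∧ ⌊ c ≟ j ⌋ ] ≡ [ b ]
  fibre true  c = ∑[≟]≡1 c
  fibre false c = sum-replicate-zero m

∑-remove-point : ∀ {n} (b : Fin n → Bool) (w : Fin n) →
                 ∑[ v < n ] [ b v ] ≡ [ b w ] ℕ.+ ∑[ v < n ] [ not ⌊ v ≟ w ⌋ ∧ b v ]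
∑-remove-point b zero    = refl
∑-remove-point {suc n} b (suc w) = begin
  [ b zero ] ℕ.+ ∑[ v < n ] [ b (suc v) ]
    ≡⟨ cong ([ b zero ] ℕ.+_) (∑-remove-point (b ∘ suc) w) ⟩
  [ b zero ] ℕ.+ ([ b (suc w) ] ℕ.+ rest)
    ≡⟨ x∙yz≈y∙xz [ b zero ] [ b (suc w) ] rest ⟩
  [ b (suc w) ] ℕ.+ ([ b zero ] ℕ.+ rest)
    ≡⟨ cong (λ t → [ b (suc w) ] ℕ.+ ([ b zero ] ℕ.+ t)) (sum-cong-≗ shift) ⟨
  [ b (suc w) ] ℕ.+ ∑[ v < suc n ] [ not ⌊ v ≟ suc w ⌋ ∧ b v ] ∎
  where
  open ≡-Reasoning
  rest = ∑[ v < n ] [ not ⌊ v ≟ w ⌋ ∧ b (suc v) ]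
  shift : ∀ v → [ not ⌊ suc v ≟ suc w ⌋ ∧ b (suc v) ] ≡ [ not ⌊ v ≟ w ⌋ ∧ b (suc v) ]
  shift v = cong (λ e → [ not e ∧ b (suc v) ]) (⌊suc≟suc⌋ v w)

∣p∪⁅x⁆∣≡1+∣p∣ : ∀ {n} (p : Subset n) {x} → x ∉ p → ∣ p ∪ ⁅ x ⁆ ∣ ≡ suc ∣ p ∣
∣p∪⁅x⁆∣≡1+∣p∣ (false ∷ p) {zero}  x∉p = cong (suc ∘ ∣_∣) (∪-identityʳ p)
∣p∪⁅x⁆∣≡1+∣p∣ (true  ∷ p) {zero}  x∉p = ⊥-elim (x∉p here)
∣p∪⁅x⁆∣≡1+∣p∣ (false ∷ p) {suc x} x∉p = ∣p∪⁅x⁆∣≡1+∣p∣ p (x∉p ∘ there)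
∣p∪⁅x⁆∣≡1+∣p∣ (true  ∷ p) {suc x} x∉p = cong suc (∣p∪⁅x⁆∣≡1+∣p∣ p (x∉p ∘ there))

sum∘tabulate : ∀ {n} (f : Fin n → ℕ) → Vec.sum (tabulate f) ≡ sum f
sum∘tabulate {zero}  f = refl
sum∘tabulate {suc n} f = cong (f zero ℕ.+_) (sum∘tabulate (f ∘ suc))

totalSize-⊥ : ∀ {n r} → totalSize {n} {r} (λ _ → ⊥) ≡ 0
totalSize-⊥ {n} {r} = begin
  totalSize {n} {r} (λ _ → ⊥)   ≡⟨ sum∘tabulate {r} (λ _ → ∣ ⊥ {n} ∣) ⟩
  ∑[ i < r ] ∣ ⊥ {n} ∣          ≡⟨ cong (λ k → ∑[ i < r ] k) (∣⊥∣≡0 n) ⟩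
  ∑[ i < r ] 0                  ≡⟨ sum-replicate-zero r ⟩
  0                             ∎
  where open ≡-Reasoning

sum-increment : ∀ {n} (f g : Fin (suc n) → ℕ) (j : Fin (suc n)) →
                g j ≡ suc (f j) → (∀ k → k ≢ j → g k ≡ f k) → sum g ≡ suc (sum f)
sum-increment f g j gj≡1+fj g≗f = begin
  sum g                                ≡⟨ sum-remove g ⟩
  g j ℕ.+ sum (removeAt g j)           ≡⟨ cong₂ ℕ._+_ gj≡1+fj (sum-cong-≗ rest) ⟩
  suc (f j ℕ.+ sum (removeAt f j))     ≡⟨ cong suc (sum-remove f) ⟨
  suc (sum f)                          ∎
  where
  open ≡-Reasoning
  rest : ∀ k → removeAt g j k ≡ removeAt f j k
  rest k = g≗f (punchIn j k) (punchInᵢ≢i j k)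

module _ {n r} (χ : Colouring n r) where

  lookup-N∩ : ∀ j w W v →
              lookup (N χ j w ∩ W) v ≡ (not ⌊ v ≟ w ⌋ ∧ lookup W v) ∧ ⌊ col χ w v ≟ j ⌋
  lookup-N∩ j w W v = begin
    lookup (N χ j w ∩ W) v                              ≡⟨ lookup-zipWith _∧_ v (N χ j w) W ⟩
    lookup (N χ j w) v ∧ lookup W v                     ≡⟨ cong (_∧ lookup W v) (lookup∘tabulate _ v) ⟩
    (not ⌊ v ≟ w ⌋ ∧ ⌊ col χ w v ≟ j ⌋) ∧ lookup W v    ≡⟨ ∧.xy∙z≈xz∙y (not ⌊ v ≟ w ⌋) _ (lookup W v) ⟩
    (not ⌊ v ≟ w ⌋ ∧ lookup W v) ∧ ⌊ col χ w v ≟ j ⌋    ∎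
    where open ≡-Reasoning

  ∈N⁻ : ∀ {j w v} → v ∈ N χ j w → v ≢ w × col χ w v ≡ j
  ∈N⁻ {j} {w} {v} v∈N with v ≟ w | col χ w v ≟ j | trans (sym (lookup∘tabulate _ v)) ([]=⇒lookup v∈N)
  ... | no v≢w | yes c≡j | _  = v≢w , c≡j
  ... | no _   | no _    | ()
  ... | yes _  | _       | ()

  degree-sum : ∀ W {w} → w ∈ W → suc (∑[ j < r ] ∣ N χ j w ∩ W ∣) ≡ ∣ W ∣
  degree-sum W {w} w∈W = begin
    suc (∑[ j < r ] ∣ N χ j w ∩ W ∣)
      ≡⟨ cong suc (sum-cong-≗ count-N∩) ⟩
    suc (∑[ j < r ] ∑[ v < n ] [ (not ⌊ v ≟ w ⌋ ∧ lookup W v) ∧ ⌊ col χ w v ≟ j ⌋ ])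
      ≡⟨ cong suc (∑-fibres (λ v → not ⌊ v ≟ w ⌋ ∧ lookup W v) (col χ w)) ⟩
    [ true ] ℕ.+ ∑[ v < n ] [ not ⌊ v ≟ w ⌋ ∧ lookup W v ]
      ≡⟨ cong (λ b → [ b ] ℕ.+ ∑[ v < n ] [ not ⌊ v ≟ w ⌋ ∧ lookup W v ]) ([]=⇒lookup w∈W) ⟨
    [ lookup W w ] ℕ.+ ∑[ v < n ] [ not ⌊ v ≟ w ⌋ ∧ lookup W v ]
      ≡⟨ ∑-remove-point (lookup W) w ⟨
    ∑[ v < n ] [ lookup W v ]
      ≡⟨ ∣p∣≡∑[lookup] W ⟨
    ∣ W ∣ ∎
    where
    open ≡-Reasoning
    count-N∩ : ∀ j → ∣ N χ j w ∩ W ∣ ≡ ∑[ v < n ] [ (not ⌊ v ≟ w ⌋ ∧ lookup W v) ∧ ⌊ col χ w v ≟ j ⌋ ]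
    count-N∩ j = trans (∣p∣≡∑[lookup] (N χ j w ∩ W)) (sum-cong-≗ (cong [_] ∘ lookup-N∩ j w W))

MonoBook-intro : ∀ {n r} (χ : Colouring n r) {i A B} →
                 (∀ x y → x ≢ y → x ∈ A → y ∈ A ⊎ y ∈ B → col χ x y ≡ i) → MonoBook χ i A B
MonoBook-intro χ book x y x≢y (inj₁ (x∈A , y∈)) = book x y x≢y x∈A y∈
MonoBook-intro χ book x y x≢y (inj₂ (x∈B , y∈A)) = trans (symm χ x y) (book y x (x≢y ∘ sym) y∈A (inj₂ x∈B))

module Greedy {n r : ℕ} (ε : ℚ) .{{_ : NonNegative ε}} (χ : Colouring n (suc r)) where

  u q : ℚ
  u = + 1 / suc r
  q = (1ℚ + ε) * u

  instance
    u-nonNeg : NonNegative u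
    u-nonNeg = normalize-nonNeg 1 (suc r)

    q-nonNeg : NonNegative q
    q-nonNeg = nonNeg*nonNeg⇒nonNeg (1ℚ + ε) {{nonNeg+nonNeg⇒nonNeg 1ℚ ε}} u

  Parts : Set
  Parts = Fin (suc r) → Subset n

  Typical : Subset n → Set
  Typical W = ∀ i w → w ∈ W → (u - ε) * ℕ→ℚ ∣ W ∣ - 1ℚ ≤ ℕ→ℚ ∣ N χ i w ∩ W ∣

  Light : Subset n → Fin (suc r) → Fin n → Set
  Light W i w = ℕ→ℚ ∣ N χ i w ∩ W ∣ < (u - ε) * ℕ→ℚ ∣ W ∣ - 1ℚ

  Heavy : Subset n → Fin (suc r) → Fin n → Set
  Heavy W j w = q * ℕ→ℚ ∣ W ∣ ≤ ℕ→ℚ ∣ N χ j w ∩ W ∣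

  record Invariant (S : Parts) (W : Subset n) : Set where
    field
      parts-disjoint   : ∀ i j → i ≢ j → Disjoint (S i) (S j)
      parts-disjoint-W : ∀ i → Disjoint (S i) W
      W-large          : (q ^ℚ totalSize S) * ℕ→ℚ n ≤ ℕ→ℚ ∣ W ∣
      books            : ∀ i → MonoBook χ i (S i) W

  light? : ∀ W → Dec (∃[ i ] ∃[ w ] (w ∈ W × Light W i w))
  light? W = any? (λ i → any? (λ w → (w ∈? W) ×-dec (_ <? _)))

  heavy? : ∀ W w → Dec (∃[ j ] Heavy W j w)
  heavy? W w = any? (λ j → _ ≤? _)

  light⇒heavy : ∀ W {i w} → w ∈ W → Light W i w → ∃[ j ] Heavy W j w
  light⇒heavy W {i} {w} w∈W light =
    decidable-stable (heavy? W w) (λ none → <-irrefl refl (<-≤-trans light (not-light none)))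
    where
    not-light : ¬ (∃[ j ] Heavy W j w) → (u - ε) * ℕ→ℚ ∣ W ∣ - 1ℚ ≤ ℕ→ℚ ∣ N χ i w ∩ W ∣
    not-light none = upper-bounds⇒lower-bound u ε (ℕ→ℚ-*-inverseʳ (suc r)) (λ j → ∣ N χ j w ∩ W ∣)
      {∣ W ∣} (degree-sum χ W w∈W) (λ j → <⇒≤ (≰⇒> (none ∘ (j ,_)))) i

  typical-or-heavy : ∀ W → Typical W ⊎ ∃[ j ] ∃[ w ] (w ∈ W × Heavy W j w)
  typical-or-heavy W = [ inj₂ ∘ heavy-vertex , inj₁ ∘ no-light⇒typical ]′ (toSum (light? W))
    where
    heavy-vertex : ∃[ i ] ∃[ w ] (w ∈ W × Light W i w) → ∃[ j ] ∃[ w ] (w ∈ W × Heavy W j w)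
    heavy-vertex (i , w , w∈W , light) = map₂ (λ heavy → w , w∈W , heavy) (light⇒heavy W w∈W light)
    no-light⇒typical : ¬ (∃[ i ] ∃[ w ] (w ∈ W × Light W i w)) → Typical W
    no-light⇒typical none i w w∈W = ≮⇒≥ (λ light → none (i , w , w∈W , light))

  add : Parts → Fin (suc r) → Fin n → Parts
  add S j w = updateAt S j (_∪ ⁅ w ⁆)

  ∈-add⁻ : ∀ S j w {k v} → v ∈ add S j w k → v ∈ S k ⊎ (k ≡ j × v ≡ w)
  ∈-add⁻ S j w {k} {v} v∈ with k ≟ j
  ... | no k≢j = inj₁ (subst (v ∈_) (updateAt-minimal k j S k≢j) v∈)
  ... | yes refl with x∈p∪q⁻ (S j) ⁅ w ⁆ (subst (v ∈_) (updateAt-updates j S) v∈)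
  ...   | inj₁ v∈S = inj₁ v∈S
  ...   | inj₂ v∈w = inj₂ (refl , x∈⁅y⁆⇒x≡y w v∈w)

  totalSize-add : ∀ S j {w} → w ∉ S j → totalSize (add S j w) ≡ suc (totalSize S)
  totalSize-add S j {w} w∉S = begin
    totalSize (add S j w)        ≡⟨ sum∘tabulate (∣_∣ ∘ add S j w) ⟩
    sum (∣_∣ ∘ add S j w)        ≡⟨ sum-increment (∣_∣ ∘ S) (∣_∣ ∘ add S j w) j size-j size-k ⟩
    suc (sum (∣_∣ ∘ S))          ≡⟨ cong suc (sum∘tabulate (∣_∣ ∘ S)) ⟨
    suc (totalSize S)            ∎
    where
    open ≡-Reasoning
    size-j : ∣ add S j w j ∣ ≡ suc ∣ S j ∣
    size-j = trans (cong ∣_∣ (updateAt-updates j S)) (∣p∪⁅x⁆∣≡1+∣p∣ (S j) w∉S)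
    size-k : ∀ k → k ≢ j → ∣ add S j w k ∣ ≡ ∣ S k ∣
    size-k k k≢j = cong ∣_∣ (updateAt-minimal k j S k≢j)

  module Step {S W j w} (inv : Invariant S W) (w∈W : w ∈ W) (heavy : Heavy W j w) where
    open Invariant inv

    S′ : Parts
    S′ = add S j w

    W′ : Subset n
    W′ = N χ j w ∩ W

    ∈W′⁻ : ∀ {v} → v ∈ W′ → (v ≢ w × col χ w v ≡ j) × v ∈ W
    ∈W′⁻ v∈ with x∈p∩q⁻ (N χ j w) W v∈
    ... | v∈N , v∈W = ∈N⁻ χ v∈N , v∈W

    shrinks : ∣ W′ ∣ ℕ.< ∣ W ∣
    shrinks = p⊂q⇒∣p∣<∣q∣ (p∩q⊆q (N χ j w) W , w , w∈W , λ w∈W′ → proj₁ (proj₁ (∈W′⁻ w∈W′)) refl)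

    new⇒old : ∀ {k v} → v ∈ S′ k ⊎ v ∈ W′ → v ∈ S k ⊎ v ∈ W
    new⇒old (inj₁ v∈S′) with ∈-add⁻ S j w v∈S′
    ... | inj₁ v∈S        = inj₁ v∈S
    ... | inj₂ (_ , refl) = inj₂ w∈W
    new⇒old (inj₂ v∈W′) = inj₂ (proj₂ (∈W′⁻ v∈W′))

    parts-disjoint′ : ∀ k l → k ≢ l → Disjoint (S′ k) (S′ l)
    parts-disjoint′ k l k≢l v v∈k v∈l with ∈-add⁻ S j w v∈k | ∈-add⁻ S j w v∈l
    ... | inj₁ v∈Sk       | inj₁ v∈Sl       = parts-disjoint k l k≢l v v∈Sk v∈Sl
    ... | inj₁ v∈Sk       | inj₂ (_ , refl) = parts-disjoint-W k v v∈Sk w∈W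
    ... | inj₂ (_ , refl) | inj₁ v∈Sl       = parts-disjoint-W l v v∈Sl w∈W
    ... | inj₂ (refl , _) | inj₂ (refl , _) = k≢l refl

    parts-disjoint-W′ : ∀ k → Disjoint (S′ k) W′
    parts-disjoint-W′ k v v∈S′ v∈W′ with ∈-add⁻ S j w v∈S′
    ... | inj₁ v∈S       = parts-disjoint-W k v v∈S (proj₂ (∈W′⁻ v∈W′))
    ... | inj₂ (_ , v≡w) = proj₁ (proj₁ (∈W′⁻ v∈W′)) v≡w

    W′-large : (q ^ℚ totalSize S′) * ℕ→ℚ n ≤ ℕ→ℚ ∣ W′ ∣
    W′-large = begin
      (q ^ℚ totalSize S′) * ℕ→ℚ n        ≡⟨ cong (λ t → (q ^ℚ t) * ℕ→ℚ n) (totalSize-add S j w∉Sj) ⟩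
      q * (q ^ℚ totalSize S) * ℕ→ℚ n     ≡⟨ *-assoc q _ _ ⟩
      q * ((q ^ℚ totalSize S) * ℕ→ℚ n)   ≤⟨ *-monoˡ-≤-nonNeg q W-large ⟩
      q * ℕ→ℚ ∣ W ∣                       ≤⟨ heavy ⟩
      ℕ→ℚ ∣ W′ ∣                          ∎
      where
      open ≤-Reasoning
      w∉Sj : w ∉ S j
      w∉Sj w∈Sj = parts-disjoint-W j w w∈Sj w∈W

    books′ : ∀ k → MonoBook χ k (S′ k) W′
    books′ k = MonoBook-intro χ book
      where
      book : ∀ x y → x ≢ y → x ∈ S′ k → y ∈ S′ k ⊎ y ∈ W′ → col χ x y ≡ k
      book x y x≢y x∈S′ y∈ with ∈-add⁻ S j w x∈S′
      ... | inj₁ x∈S = books k x y x≢y (inj₁ (x∈S , new⇒old y∈))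
      ... | inj₂ (refl , refl) with y∈
      ...   | inj₂ y∈W′ = proj₂ (proj₁ (∈W′⁻ y∈W′))
      ...   | inj₁ y∈S′ with ∈-add⁻ S j w y∈S′
      ...     | inj₁ y∈S        = trans (symm χ x y) (books k y x (x≢y ∘ sym) (inj₁ (y∈S , inj₂ w∈W)))
      ...     | inj₂ (_ , refl) = ⊥-elim (x≢y refl)

    invariant : Invariant S′ W′
    invariant = record
      { parts-disjoint   = parts-disjoint′
      ; parts-disjoint-W = parts-disjoint-W′
      ; W-large          = W′-large
      ; books            = books′
      }

  invariant-init : Invariant (λ _ → ⊥) ⊤
  invariant-init .Invariant.parts-disjoint i j _ v v∈⊥ _ = ∉⊥ v∈⊥
  invariant-init .Invariant.parts-disjoint-W i v v∈⊥ _   = ∉⊥ v∈⊥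
  invariant-init .Invariant.W-large = ≤-reflexive (begin
    (q ^ℚ totalSize {n} {suc r} (λ _ → ⊥)) * ℕ→ℚ n
      ≡⟨ cong (λ t → (q ^ℚ t) * ℕ→ℚ n) (totalSize-⊥ {n} {suc r}) ⟩
    1ℚ * ℕ→ℚ n
      ≡⟨ *-identityˡ (ℕ→ℚ n) ⟩
    ℕ→ℚ n
      ≡⟨ cong ℕ→ℚ (∣⊤∣≡n n) ⟨
    ℕ→ℚ ∣ ⊤ {n} ∣ ∎)
    where open ≡-Reasoning
  invariant-init .Invariant.books i x y _ (inj₁ (x∈⊥ , _)) = ⊥-elim (∉⊥ x∈⊥)
  invariant-init .Invariant.books i x y _ (inj₂ (_ , y∈⊥)) = ⊥-elim (∉⊥ y∈⊥)

  Decomposition : Set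
  Decomposition = Σ[ S ∈ Parts ] Σ[ W ∈ Subset n ] (Invariant S W × Typical W)

  greedy : ∀ fuel S W → ∣ W ∣ ℕ.< fuel → Invariant S W → Decomposition
  greedy (suc fuel) S W |W|<1+fuel inv = [ done , refine ]′ (typical-or-heavy W)
    where
    done : Typical W → Decomposition
    done typical = S , W , inv , typical
    refine : ∃[ j ] ∃[ w ] (w ∈ W × Heavy W j w) → Decomposition
    refine (j , w , w∈W , heavy) =
      greedy fuel (add S j w) (N χ j w ∩ W) (ℕ.<-≤-trans shrinks (ℕ.≤-pred |W|<1+fuel)) invariant
      where open Step inv w∈W heavy using (shrinks; invariant)

  decomposition : Decomposition
  decomposition = greedy (suc n) (λ _ → ⊥) ⊤ (ℕ.s≤s (ℕ.≤-reflexive (∣⊤∣≡n n))) invariant-init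

lemma5p2 : (n r : ℕ) → .{{_ : NonZero r}} → (ε : ℚ) → 0ℚ < ε → (χ : Colouring n r) →
    Σ[ S ∈ (Fin r → Subset n) ] Σ[ W ∈ Subset n ]
      ((∀ i j → i ≢ j → Disjoint (S i) (S j))
      × (∀ i → Disjoint (S i) W)
      × (((1ℚ + ε) * ((+ 1) / r)) ^ℚ totalSize S) * ℕ→ℚ n ≤ ℕ→ℚ ∣ W ∣
      × (∀ i → (∀ w → w ∈ W →
            ((((+ 1) / r) - ε) * ℕ→ℚ ∣ W ∣) - 1ℚ ≤ ℕ→ℚ ∣ N χ i w ∩ W ∣)
          × MonoBook χ i (S i) W))
lemma5p2 n (suc r) ε 0<ε χ =
  let S , W , inv , typical = decomposition
      open Invariant inv
  in S , W , parts-disjoint , parts-disjoint-W , W-large , λ i → typical i , books i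
  where open Greedy ε {{pos⇒nonNeg ε {{positive 0<ε}}}} χ
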